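{- Let $f_i\colon M_i\to M_{i+1}$ ($i\geqslant 0$) be a sequence of posets and monotone maps. Then: (1) Each $f'_i\colon\Sigma_iM_i\to\Sigma_{i+1}M_{i+1}$ is order-reflecting (hence injective) and has down-closed image; moreover, each $\iota^n_j\colon M_j\to\Sigma_nM_n$ ($0\leqslant j\leqslant n$) is order-reflecting (hence injective). (2) If $M_n$ has a top element, then so does $\Sigma_nM_n$, and $\iota^n_n$ preserves the top element. (3) If each $M_i$ has a bottom element and each $f_i$ preserves it, then each $\Sigma_nM_n$ has a bottom element, and $\iota^n_0$, as well as each $f'_i$, preserves the bottom element. (4) If each $M_i$ has binary joins and each $f_i$ preserves them, then each $\Sigma_nM_n$ has binary joins, and each $f'_i$ and each $\iota^n_j$ preserves binary joins. (5) If each $M_i$ has binary meets and each $f_i$ is order-reflecting with down-closed image, then each $\Sigma_nM_n$ has binary meets, and each $\iota^n_j$ preserves binary meets (as does each $f_i$ and each $f'_i$).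
   Context: Stacking (lax sum): for $n\geqslant 0$, the poset $\Sigma_nM_n$ has elements the pairs $(x,j)$ with $0\leqslant j\leqslant n$, $x\in M_j$, ordered by $(x,j)\leqslant(y,k)$ iff $j\leqslant k$ and $(f_{k-1}\circ\dots\circ f_j)(x)\leqslant y$ in $M_k$ (identity composite when $j=k$). The maps are $\iota^n_j\colon M_j\to\Sigma_nM_n$, $\iota^n_j(x)=(x,j)$, and $f'_i\colon\Sigma_iM_i\to\Sigma_{i+1}M_{i+1}$, $f'_i(x,j)=(x,j)$. A map is order-reflecting if $g(a)\leqslant g(b)$ implies $a\leqslant b$. -}

module Defs where

open import Level using (Level; _⊔_)
open import Data.Nat using (ℕ; zero; suc; _≤_; _≤′_; ≤′-reflexive; ≤′-step)
open import Data.Nat.Properties using (m≤n⇒m≤1+n)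
open import Data.Product using (Σ; ∃; _×_; _,_)
open import Relation.Binary using (Rel; Poset)
open import Relation.Binary.PropositionalEquality using (_≡_; subst)

private variable
  a b ℓ ℓ′ ℓ₂ ℓ₂′ : Level
  A : Set a
  B : Set b

OrderReflecting : Rel A ℓ → Rel B ℓ′ → (A → B) → Set _
OrderReflecting _≤₁_ _≤₂_ g = ∀ x y → g x ≤₂ g y → x ≤₁ y

Injective : Rel A ℓ → Rel B ℓ′ → (A → B) → Set _
Injective _≈₁_ _≈₂_ g = ∀ x y → g x ≈₂ g y → x ≈₁ y

DownClosedImage : {A : Set a} → Rel B ℓ → Rel B ℓ′ → (A → B) → Set _
DownClosedImage {A = A} _≤₂_ _≈₂_ g = ∀ (x : A) y → y ≤₂ g x → ∃ λ z → g z ≈₂ y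

IsTop : Rel A ℓ → A → Set _
IsTop _≤_ t = ∀ x → x ≤ t

IsBottom : Rel A ℓ → A → Set _
IsBottom _≤_ t = ∀ x → t ≤ x

HasTop : {A : Set a} → Rel A ℓ → Set _
HasTop _≤_ = ∃ λ t → IsTop _≤_ t

HasBottom : {A : Set a} → Rel A ℓ → Set _
HasBottom _≤_ = ∃ λ t → IsBottom _≤_ t

PreservesTop : Rel A ℓ → Rel B ℓ′ → (A → B) → Set _
PreservesTop _≤₁_ _≤₂_ g = ∀ t → IsTop _≤₁_ t → IsTop _≤₂_ (g t)

PreservesBottom : Rel A ℓ → Rel B ℓ′ → (A → B) → Set _
PreservesBottom _≤₁_ _≤₂_ g = ∀ t → IsBottom _≤₁_ t → IsBottom _≤₂_ (g t)

IsJoin : Rel A ℓ → A → A → A → Set _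
IsJoin _≤_ x y z = x ≤ z × y ≤ z × (∀ w → x ≤ w → y ≤ w → z ≤ w)

IsMeet : Rel A ℓ → A → A → A → Set _
IsMeet _≤_ x y z = z ≤ x × z ≤ y × (∀ w → w ≤ x → w ≤ y → w ≤ z)

HasJoins : {A : Set a} → Rel A ℓ → Set _
HasJoins _≤_ = ∀ x y → ∃ λ z → IsJoin _≤_ x y z

HasMeets : {A : Set a} → Rel A ℓ → Set _
HasMeets _≤_ = ∀ x y → ∃ λ z → IsMeet _≤_ x y z

PreservesJoins : Rel A ℓ → Rel B ℓ′ → (A → B) → Set _
PreservesJoins _≤₁_ _≤₂_ g = ∀ x y z → IsJoin _≤₁_ x y z → IsJoin _≤₂_ (g x) (g y) (g z)

PreservesMeets : Rel A ℓ → Rel B ℓ′ → (A → B) → Set _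
PreservesMeets _≤₁_ _≤₂_ g = ∀ x y z → IsMeet _≤₁_ x y z → IsMeet _≤₂_ (g x) (g y) (g z)

module Stack {c ℓ₁ ℓ₂ : Level} (M : ℕ → Poset c ℓ₁ ℓ₂)
             (f : ∀ i → Poset.Carrier (M i) → Poset.Carrier (M (suc i))) where

  ∣_∣ : ℕ → Set c
  ∣ i ∣ = Poset.Carrier (M i)

  comp : ∀ {j k} → j ≤′ k → ∣ j ∣ → ∣ k ∣
  comp (≤′-reflexive e) x = subst ∣_∣ e x
  comp (≤′-step {n} p) x = f n (comp p x)

  -- elements (x , j) of Σ_n M_n with 0 ≤ j ≤ n and x ∈ M_j
  record Elem (n : ℕ) : Set c where
    constructor ⟨_,_,_⟩
    field
      idx   : ℕ
      bound : idx ≤ n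
      elt   : ∣ idx ∣

  _⊑_ : ∀ {n} → Elem n → Elem n → Set ℓ₂
  ⟨ j , _ , x ⟩ ⊑ ⟨ k , _ , y ⟩ = Σ (j ≤′ k) λ p → Poset._≤_ (M k) (comp p x) y

  _≋_ : ∀ {n} → Elem n → Elem n → Set ℓ₁
  ⟨ j , _ , x ⟩ ≋ ⟨ k , _ , y ⟩ = Σ (j ≡ k) λ e → Poset._≈_ (M k) (subst ∣_∣ e x) y

  ι : ∀ n j → j ≤ n → ∣ j ∣ → Elem n
  ι n j p x = ⟨ j , p , x ⟩

  f′ : ∀ i → Elem i → Elem (suc i)
  f′ i ⟨ j , p , x ⟩ = ⟨ j , m≤n⇒m≤1+n p , x ⟩

-- Σ_n M_n glues the M_j along the composites f_{k-1} ∘ … ∘ f_j, and f′_i embeds Σ_i into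
-- Σ_{i+1} as the down-set of elements of index ≤ i.  Tops sit at index n and bottoms at
-- index 0.  A join of (x , j) and (y , k) with j ≤ k is formed in M_k after pushing x
-- forward; the meet is formed there too, then pulled back to index j, which is possible
-- because the composite is an embedding with down-closed image.  Such an embedding
-- preserves all meets, and all joins once its codomain has joins; this yields the
-- preservation statements for f_i and f′_i.

module Submission where

open import Defs
open import Level using (Level)
open import Data.Nat using (ℕ; suc; _≤_; z≤n; _≤′_; ≤′-reflexive; ≤′-refl; ≤′-step)
open import Data.Nat.Properties
  using (≤-refl; ≤-trans; ≤-total; ≡-irrelevant; ≤′-trans; ≤′⇒≤; ≤⇒≤′; 1+n≰n)
open import Data.Product using (∃; _×_; _,_; proj₁; proj₂)
open import Data.Sum using (inj₁; inj₂)
open import Data.Empty using (⊥-elim)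
open import Relation.Binary using (Rel; Poset; Preorder; Total; Transitive; IsEquivalence; _Preserves_⟶_)
open import Relation.Binary.Morphism.Structures using (IsOrderHomomorphism)
open import Relation.Binary.PropositionalEquality using (_≡_; refl; cong; subst)
import Relation.Binary.Reasoning.Preorder as PreorderReasoning
import Relation.Binary.Reasoning.PartialOrder as PosetReasoning

module _ {a ℓ : Level} {A : Set a} {_≤_ : Rel A ℓ} where

  IsJoin-comm : ∀ {x y z} → IsJoin _≤_ x y z → IsJoin _≤_ y x z
  IsJoin-comm (x≤z , y≤z , least) = y≤z , x≤z , λ w y≤w x≤w → least w x≤w y≤w

  IsMeet-comm : ∀ {x y z} → IsMeet _≤_ x y z → IsMeet _≤_ y x z
  IsMeet-comm (z≤x , z≤y , greatest) = z≤y , z≤x , λ w w≤y w≤x → greatest w w≤x w≤y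

  module _ {b r : Level} {B : Set b} {_≼_ : Rel B r} (total : Total _≼_) (key : A → B) where

    HasJoins-wlog : (∀ x y → key x ≼ key y → ∃ (IsJoin _≤_ x y)) → HasJoins _≤_
    HasJoins-wlog ordered x y with total (key x) (key y)
    ... | inj₁ x≼y = ordered x y x≼y
    ... | inj₂ y≼x = let (z , z-join) = ordered y x y≼x in z , IsJoin-comm {y} {x} {z} z-join

    HasMeets-wlog : (∀ x y → key x ≼ key y → ∃ (IsMeet _≤_ x y)) → HasMeets _≤_
    HasMeets-wlog ordered x y with total (key x) (key y)
    ... | inj₁ x≼y = ordered x y x≼y
    ... | inj₂ y≼x = let (z , z-meet) = ordered y x y≼x in z , IsMeet-comm {y} {x} {z} z-meet

module _ {a₁ a₂ a₃ b₁ b₂ b₃ : Level} {A : Preorder a₁ a₂ a₃} {B : Preorder b₁ b₂ b₃}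
         {g : Preorder.Carrier A → Preorder.Carrier B}
         (mono : g Preserves Preorder._≲_ A ⟶ Preorder._≲_ B)
         (reflects : OrderReflecting (Preorder._≲_ A) (Preorder._≲_ B) g)
         (downClosed : DownClosedImage (Preorder._≲_ B) (Preorder._≈_ B) g) where
  private
    module A = Preorder A
    module B = Preorder B
  open PreorderReasoning B

  embedding-preservesMeets : PreservesMeets A._≲_ B._≲_ g
  embedding-preservesMeets x y z (z≤x , z≤y , greatest) =
    mono z≤x , mono z≤y , λ w w≤gx w≤gy →
      let (u , gu≈w) = downClosed x w w≤gx
          below : ∀ {v} → w B.≲ g v → u A.≲ v
          below {v} w≤gv = reflects u v (B.trans (B.reflexive gu≈w) w≤gv)
      in begin
        w    ≈⟨ gu≈w ⟨
        g u  ≲⟨ mono (greatest u (below w≤gx) (below w≤gy)) ⟩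
        g z  ∎

  -- The join of g x and g y in B lies below g z, hence in the image of g, and its
  -- preimage is an upper bound of x and y.
  embedding-preservesJoins : HasJoins B._≲_ → PreservesJoins A._≲_ B._≲_ g
  embedding-preservesJoins joins x y z (x≤z , y≤z , least) =
    mono x≤z , mono y≤z , λ w gx≤w gy≤w →
      let (k , gx≤k , gy≤k , least-k) = joins (g x) (g y)
          (u , gu≈k) = downClosed z k (least-k (g z) (mono x≤z) (mono y≤z))
          above : ∀ {v} → g v B.≲ k → v A.≲ u
          above {v} gv≤k = reflects v u (B.trans gv≤k (B.reflexive (B.Eq.sym gu≈k)))
      in begin
        g z  ≲⟨ mono (least u (above gx≤k) (above gy≤k)) ⟩
        g u  ≈⟨ gu≈k ⟩
        k    ≲⟨ least-k w gx≤w gy≤w ⟩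
        w    ∎

module StackProperties {c ℓ₁ ℓ₂ : Level} (M : ℕ → Poset c ℓ₁ ℓ₂)
    (f : ∀ i → Poset.Carrier (M i) → Poset.Carrier (M (suc i))) where
  open Stack M f
  private module M i = Poset (M i)

  comp-irrelevant : ∀ {j k} (p q : j ≤′ k) (x : ∣ j ∣) → comp p x ≡ comp q x
  comp-irrelevant (≤′-reflexive e) (≤′-reflexive e′) x = cong (λ e → subst ∣_∣ e x) (≡-irrelevant e e′)
  comp-irrelevant ≤′-refl (≤′-step q) x = ⊥-elim (1+n≰n (≤′⇒≤ q))
  comp-irrelevant (≤′-step p) ≤′-refl x = ⊥-elim (1+n≰n (≤′⇒≤ p))
  comp-irrelevant (≤′-step p) (≤′-step q) x = cong (f _) (comp-irrelevant p q x)

  comp-refl : ∀ {j} (p : j ≤′ j) (x : ∣ j ∣) → comp p x ≡ x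
  comp-refl p x = comp-irrelevant p ≤′-refl x

  comp-trans : ∀ {j k l} (p : j ≤′ k) (q : k ≤′ l) (x : ∣ j ∣) →
               comp (≤′-trans p q) x ≡ comp q (comp p x)
  comp-trans p ≤′-refl x = refl
  comp-trans p (≤′-step q) x = cong (f _) (comp-trans p q x)

  comp-≤-irrelevant : ∀ {j k} (p q : j ≤′ k) {x : ∣ j ∣} {y : ∣ k ∣} →
                      M._≤_ k (comp p x) y → M._≤_ k (comp q x) y
  comp-≤-irrelevant {k = k} p q {x} {y} = subst (λ t → M._≤_ k t y) (comp-irrelevant p q x)

  comp-≤-trans : ∀ {j k l} (p : j ≤′ k) (q : k ≤′ l) (r : j ≤′ l) {x : ∣ j ∣} {y : ∣ l ∣} →
                 M._≤_ l (comp r x) y → M._≤_ l (comp q (comp p x)) y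
  comp-≤-trans {l = l} p q r {x} {y} rx≤y =
    subst (λ t → M._≤_ l t y) (comp-trans p q x) (comp-≤-irrelevant r (≤′-trans p q) rx≤y)

  -- ⊑ ignores the bounds idx ≤ n, so f′ is the identity on the order and on ≋.
  f′-reflects : ∀ i → OrderReflecting (_⊑_ {i}) (_⊑_ {suc i}) (f′ i)
  f′-reflects i x y fx⊑fy = fx⊑fy

  f′-injective : ∀ i → Injective (_≋_ {i}) (_≋_ {suc i}) (f′ i)
  f′-injective i x y fx≋fy = fx≋fy

  f′-downClosed : ∀ i → DownClosedImage (_⊑_ {suc i}) (_≋_ {suc i}) (f′ i)
  f′-downClosed i ⟨ j , j≤i , _ ⟩ ⟨ k , _ , y ⟩ (k≤j , _) =
    ⟨ k , ≤-trans (≤′⇒≤ k≤j) j≤i , y ⟩ , refl , M.Eq.refl k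

  ι-reflects : ∀ n j (p : j ≤ n) → OrderReflecting (M._≤_ j) (_⊑_ {n}) (ι n j p)
  ι-reflects n j p x y (q , qx≤y) = subst (λ t → M._≤_ j t y) (comp-refl q x) qx≤y

  ι-injective : ∀ n j (p : j ≤ n) → Injective (M._≈_ j) (_≋_ {n}) (ι n j p)
  ι-injective n j p x y (e , x≈y) = subst (λ e → M._≈_ j (subst ∣_∣ e x) y) (≡-irrelevant e refl) x≈y

  ι-top : ∀ {n} (p : n ≤ n) {t} → IsTop (M._≤_ n) t → IsTop (_⊑_ {n}) (ι n n p t)
  ι-top p t-top ⟨ k , k≤n , y ⟩ = ≤⇒≤′ k≤n , t-top _

  ι-preservesMeets : ∀ n j (p : j ≤ n) → PreservesMeets (M._≤_ j) (_⊑_ {n}) (ι n j p)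
  ι-preservesMeets n j p x y z (z≤x , z≤y , greatest) =
    (≤′-refl , z≤x) , (≤′-refl , z≤y) ,
    λ { ⟨ l , _ , v ⟩ (r , rv≤x) (s , sv≤y) → r , greatest (comp r v) rv≤x (comp-≤-irrelevant s r sv≤y) }

  module _ (f-bottom : ∀ i → PreservesBottom (M._≤_ i) (M._≤_ (suc i)) (f i)) where

    comp-preservesBottom : ∀ {j k} (p : j ≤′ k) → PreservesBottom (M._≤_ j) (M._≤_ k) (comp p)
    comp-preservesBottom ≤′-refl t t-bottom = t-bottom
    comp-preservesBottom (≤′-step p) t t-bottom = f-bottom _ _ (comp-preservesBottom p t t-bottom)

    ι₀-bottom : ∀ {n} (p : 0 ≤ n) {t} → IsBottom (M._≤_ 0) t → IsBottom (_⊑_ {n}) (ι n 0 p t)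
    ι₀-bottom p t-bottom ⟨ k , _ , y ⟩ = ≤⇒≤′ z≤n , comp-preservesBottom (≤⇒≤′ z≤n) _ t-bottom y

  module _ (f-join : ∀ i → PreservesJoins (M._≤_ i) (M._≤_ (suc i)) (f i)) where

    comp-preservesJoins : ∀ {j k} (p : j ≤′ k) → PreservesJoins (M._≤_ j) (M._≤_ k) (comp p)
    comp-preservesJoins ≤′-refl x y z z-join = z-join
    comp-preservesJoins (≤′-step p) x y z z-join = f-join _ _ _ _ (comp-preservesJoins p x y z z-join)

    ι-preservesJoins : ∀ n j (p : j ≤ n) → PreservesJoins (M._≤_ j) (_⊑_ {n}) (ι n j p)
    ι-preservesJoins n j p x y z z-join@(x≤z , y≤z , _) =
      (≤′-refl , x≤z) , (≤′-refl , y≤z) ,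
      λ { ⟨ l , _ , v ⟩ (r , rx≤v) (s , sy≤v) →
          r , proj₂ (proj₂ (comp-preservesJoins r x y z z-join)) v rx≤v (comp-≤-irrelevant s r sy≤v) }

    join-along : ∀ {n j k} (q : j ≤′ k) {x : ∣ j ∣} {y z : ∣ k ∣} (j≤n : j ≤ n) (k≤n : k ≤ n) →
                 IsJoin (M._≤_ k) (comp q x) y z →
                 IsJoin (_⊑_ {n}) ⟨ j , j≤n , x ⟩ ⟨ k , k≤n , y ⟩ ⟨ k , k≤n , z ⟩
    join-along q {x} {y} {z} _ _ z-join@(qx≤z , y≤z , _) =
      (q , qx≤z) , (≤′-refl , y≤z) ,
      λ { ⟨ l , _ , v ⟩ (r , rx≤v) (s , sy≤v) →
          s , proj₂ (proj₂ (comp-preservesJoins s (comp q x) y z z-join)) v (comp-≤-trans q s r rx≤v) sy≤v }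

    stack-hasJoins : (∀ i → HasJoins (M._≤_ i)) → ∀ n → HasJoins (_⊑_ {n})
    stack-hasJoins joins n = HasJoins-wlog ≤-total Elem.idx ordered
      where
      ordered : ∀ x y → Elem.idx x ≤ Elem.idx y → ∃ (IsJoin _⊑_ x y)
      ordered ⟨ j , j≤n , x ⟩ ⟨ k , k≤n , y ⟩ j≤k =
        let (z , z-join) = joins k (comp (≤⇒≤′ j≤k) x) y
        in ⟨ k , k≤n , z ⟩ , join-along (≤⇒≤′ j≤k) j≤n k≤n z-join

  module Monotone (hom : ∀ i → IsOrderHomomorphism (M._≈_ i) (M._≈_ (suc i))
                                                    (M._≤_ i) (M._≤_ (suc i)) (f i)) where
    private
      f-mono : ∀ i → f i Preserves M._≤_ i ⟶ M._≤_ (suc i)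
      f-mono i = IsOrderHomomorphism.mono (hom i)

      f-cong : ∀ i → f i Preserves M._≈_ i ⟶ M._≈_ (suc i)
      f-cong i = IsOrderHomomorphism.cong (hom i)

    comp-mono : ∀ {j k} (p : j ≤′ k) → comp p Preserves M._≤_ j ⟶ M._≤_ k
    comp-mono ≤′-refl x≤y = x≤y
    comp-mono (≤′-step p) x≤y = f-mono _ (comp-mono p x≤y)

    ⊑-trans : ∀ {n} → Transitive (_⊑_ {n})
    ⊑-trans {_} {⟨ _ , _ , x ⟩} {⟨ _ , _ , y ⟩} {⟨ l , _ , z ⟩} (p , px≤y) (q , qy≤z) =
      ≤′-trans p q , (begin
        comp (≤′-trans p q) x  ≡⟨ comp-trans p q x ⟩
        comp q (comp p x)      ≤⟨ comp-mono q px≤y ⟩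
        comp q y               ≤⟨ qy≤z ⟩
        z                      ∎)
      where open PosetReasoning (M l)

    ≋-isEquivalence : ∀ n → IsEquivalence (_≋_ {n})
    ≋-isEquivalence n = record
      { refl  = λ { {⟨ j , _ , _ ⟩} → refl , M.Eq.refl j }
      ; sym   = λ { {⟨ j , _ , _ ⟩} (refl , x≈y) → refl , M.Eq.sym j x≈y }
      ; trans = λ { {⟨ j , _ , _ ⟩} (refl , x≈y) (refl , y≈z) → refl , M.Eq.trans j x≈y y≈z }
      }

    stack-preorder : ℕ → Preorder c ℓ₁ ℓ₂
    stack-preorder n = record
      { Carrier    = Elem n
      ; _≈_        = _≋_ {n}
      ; _≲_        = _⊑_ {n}
      ; isPreorder = record
        { isEquivalence = ≋-isEquivalence n
        ; reflexive     = λ { {⟨ j , _ , _ ⟩} (refl , x≈y) → ≤′-refl , M.reflexive j x≈y }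
        ; trans         = λ {x} {y} {z} → ⊑-trans {n} {x} {y} {z}
        }
      }

    -- A bottom of Σ_i lies below ι₀ ⊥₀, which is still a bottom in Σ_{i+1}.
    f′-preservesBottom : (∀ i → PreservesBottom (M._≤_ i) (M._≤_ (suc i)) (f i)) →
                         ∀ {⊥₀} → IsBottom (M._≤_ 0) ⊥₀ →
                         ∀ i → PreservesBottom (_⊑_ {i}) (_⊑_ {suc i}) (f′ i)
    f′-preservesBottom f-bottom {⊥₀} ⊥₀-bottom i t t-bottom w =
      ⊑-trans {suc i} {f′ i t} {ι (suc i) 0 z≤n ⊥₀} {w}
              (t-bottom (ι i 0 z≤n ⊥₀)) (ι₀-bottom f-bottom z≤n ⊥₀-bottom w)

    f′-preservesJoins : (∀ i → PreservesJoins (M._≤_ i) (M._≤_ (suc i)) (f i)) →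
                        (∀ i → HasJoins (M._≤_ i)) →
                        ∀ i → PreservesJoins (_⊑_ {i}) (_⊑_ {suc i}) (f′ i)
    f′-preservesJoins f-join joins i =
      embedding-preservesJoins {A = stack-preorder i} {B = stack-preorder (suc i)} {g = f′ i}
        (λ x⊑y → x⊑y) (f′-reflects i) (f′-downClosed i) (stack-hasJoins f-join joins (suc i))

    f′-preservesMeets : ∀ i → PreservesMeets (_⊑_ {i}) (_⊑_ {suc i}) (f′ i)
    f′-preservesMeets i =
      embedding-preservesMeets {A = stack-preorder i} {B = stack-preorder (suc i)} {g = f′ i}
        (λ x⊑y → x⊑y) (f′-reflects i) (f′-downClosed i)

    module _ (f-embedding : ∀ i → OrderReflecting (M._≤_ i) (M._≤_ (suc i)) (f i)
                                × DownClosedImage (M._≤_ (suc i)) (M._≈_ (suc i)) (f i)) where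
      private
        f-reflects : ∀ i → OrderReflecting (M._≤_ i) (M._≤_ (suc i)) (f i)
        f-reflects i = proj₁ (f-embedding i)

        f-downClosed : ∀ i → DownClosedImage (M._≤_ (suc i)) (M._≈_ (suc i)) (f i)
        f-downClosed i = proj₂ (f-embedding i)

      f-preservesMeets : ∀ i → PreservesMeets (M._≤_ i) (M._≤_ (suc i)) (f i)
      f-preservesMeets i =
        embedding-preservesMeets {A = M.preorder i} {B = M.preorder (suc i)}
          (f-mono i) (f-reflects i) (f-downClosed i)

      comp-reflects : ∀ {j k} (p : j ≤′ k) → OrderReflecting (M._≤_ j) (M._≤_ k) (comp p)
      comp-reflects ≤′-refl x y x≤y = x≤y
      comp-reflects (≤′-step p) x y fpx≤fpy = comp-reflects p x y (f-reflects _ _ _ fpx≤fpy)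

      comp-downClosed : ∀ {j k} (p : j ≤′ k) → DownClosedImage (M._≤_ k) (M._≈_ k) (comp p)
      comp-downClosed ≤′-refl x y y≤x = y , M.Eq.refl _
      comp-downClosed (≤′-step {i} p) x y y≤fpx =
        let (z , fz≈y) = f-downClosed i (comp p x) y y≤fpx
            z≤px = f-reflects i z (comp p x) (M.trans (suc i) (M.reflexive (suc i) fz≈y) y≤fpx)
            (u , pu≈z) = comp-downClosed p x z z≤px
        in u , M.Eq.trans (suc i) (f-cong i pu≈z) fz≈y

      -- The meet of comp q x and y lies below comp q x, hence is comp q u for some u.
      meet-along : ∀ {n j k} (q : j ≤′ k) {x : ∣ j ∣} {y a : ∣ k ∣} (j≤n : j ≤ n) (k≤n : k ≤ n) →
                   IsMeet (M._≤_ k) (comp q x) y a →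
                   ∃ λ u → IsMeet (_⊑_ {n}) ⟨ j , j≤n , x ⟩ ⟨ k , k≤n , y ⟩ ⟨ j , j≤n , u ⟩
      meet-along {k = k} q {x} {y} {a} _ _ (a≤qx , a≤y , greatest) =
        let (u , qu≈a) = comp-downClosed q x a a≤qx
            qu≤a = M.reflexive k qu≈a
        in u , (≤′-refl , comp-reflects q u x (M.trans k qu≤a a≤qx)) , (q , M.trans k qu≤a a≤y) ,
           λ { ⟨ l , _ , v ⟩ (r , rv≤x) (s , sv≤y) → r , comp-reflects q (comp r v) u (begin
                 comp q (comp r v)  ≤⟨ greatest _ (comp-mono q rv≤x) (comp-≤-trans r q s sv≤y) ⟩
                 a                  ≈⟨ qu≈a ⟨
                 comp q u           ∎) }
        where open PosetReasoning (M k)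

      stack-hasMeets : (∀ i → HasMeets (M._≤_ i)) → ∀ n → HasMeets (_⊑_ {n})
      stack-hasMeets meets n = HasMeets-wlog ≤-total Elem.idx ordered
        where
        ordered : ∀ x y → Elem.idx x ≤ Elem.idx y → ∃ (IsMeet _⊑_ x y)
        ordered ⟨ j , j≤n , x ⟩ ⟨ k , k≤n , y ⟩ j≤k =
          let (a , a-meet) = meets k (comp (≤⇒≤′ j≤k) x) y
              (u , u-meet) = meet-along (≤⇒≤′ j≤k) j≤n k≤n a-meet
          in ⟨ j , j≤n , u ⟩ , u-meet

theorem3p1 : {c ℓ₁ ℓ₂ : Level} (M : ℕ → Poset c ℓ₁ ℓ₂)
    (f : ∀ i → Poset.Carrier (M i) → Poset.Carrier (M (suc i)))
    → (∀ i → IsOrderHomomorphism (Poset._≈_ (M i)) (Poset._≈_ (M (suc i)))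
                                  (Poset._≤_ (M i)) (Poset._≤_ (M (suc i))) (f i))
    → let open Stack M f
      in
    ( (∀ i → OrderReflecting (_⊑_ {i}) (_⊑_ {suc i}) (f′ i)
           × Injective (_≋_ {i}) (_≋_ {suc i}) (f′ i)
           × DownClosedImage (_⊑_ {suc i}) (_≋_ {suc i}) (f′ i))
    × (∀ n j (p : j ≤ n) → OrderReflecting (Poset._≤_ (M j)) (_⊑_ {n}) (ι n j p)
           × Injective (Poset._≈_ (M j)) (_≋_ {n}) (ι n j p)) )
    × (∀ n → HasTop (Poset._≤_ (M n))
           → HasTop (_⊑_ {n}) × PreservesTop (Poset._≤_ (M n)) (_⊑_ {n}) (ι n n ≤-refl))
    × ((∀ i → HasBottom (Poset._≤_ (M i)))
       → (∀ i → PreservesBottom (Poset._≤_ (M i)) (Poset._≤_ (M (suc i))) (f i))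
       → (∀ n → HasBottom (_⊑_ {n})
              × PreservesBottom (Poset._≤_ (M 0)) (_⊑_ {n}) (ι n 0 z≤n))
         × (∀ i → PreservesBottom (_⊑_ {i}) (_⊑_ {suc i}) (f′ i)))
    × ((∀ i → HasJoins (Poset._≤_ (M i)))
       → (∀ i → PreservesJoins (Poset._≤_ (M i)) (Poset._≤_ (M (suc i))) (f i))
       → (∀ n → HasJoins (_⊑_ {n}))
         × (∀ i → PreservesJoins (_⊑_ {i}) (_⊑_ {suc i}) (f′ i))
         × (∀ n j (p : j ≤ n) → PreservesJoins (Poset._≤_ (M j)) (_⊑_ {n}) (ι n j p)))
    × ((∀ i → HasMeets (Poset._≤_ (M i)))
       → (∀ i → OrderReflecting (Poset._≤_ (M i)) (Poset._≤_ (M (suc i))) (f i)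
              × DownClosedImage (Poset._≤_ (M (suc i))) (Poset._≈_ (M (suc i))) (f i))
       → (∀ n → HasMeets (_⊑_ {n}))
         × (∀ n j (p : j ≤ n) → PreservesMeets (Poset._≤_ (M j)) (_⊑_ {n}) (ι n j p))
         × (∀ i → PreservesMeets (Poset._≤_ (M i)) (Poset._≤_ (M (suc i))) (f i))
         × (∀ i → PreservesMeets (_⊑_ {i}) (_⊑_ {suc i}) (f′ i)))
theorem3p1 M f hom =
    ( (λ i → f′-reflects i , f′-injective i , f′-downClosed i)
    , (λ n j p → ι-reflects n j p , ι-injective n j p) )
  , (λ n (t , t-top) → (ι n n ≤-refl t , ι-top ≤-refl t-top) , λ _ → ι-top ≤-refl)
  , (λ bottoms f-bottom →
       let (⊥₀ , ⊥₀-bottom) = bottoms 0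
       in (λ n → (ι n 0 z≤n ⊥₀ , ι₀-bottom f-bottom z≤n ⊥₀-bottom) , λ _ → ι₀-bottom f-bottom z≤n)
        , f′-preservesBottom f-bottom ⊥₀-bottom)
  , (λ joins f-join →
       stack-hasJoins f-join joins , f′-preservesJoins f-join joins , ι-preservesJoins f-join)
  , (λ meets f-embedding →
       stack-hasMeets f-embedding meets , ι-preservesMeets
     , f-preservesMeets f-embedding , f′-preservesMeets)
  where
  open Stack M f using (ι)
  open StackProperties M f
  open Monotone hom
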